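{- Let $n\ge1$ and let $\emptyset=Y_0\gtrdot Y_1\gtrdot\cdots\gtrdot Y_l$ be a saturated chain in the Tamari lattice $\mathcal T_n$. Fix a row index $d\in[n]$ and for $0\le j\le l$ let $h_j=h_{Y_j}(d)$ be the height of the prime path of row $d$ in $Y_j$. Then $h_0\ge h_1\ge\cdots\ge h_l$.
   Context: Young diagrams use English notation: rows indexed $1,2,\dots$ top to bottom, columns left to right, row lengths $\lambda_1\ge\lambda_2\ge\cdots$, $\lambda_j=0$ beyond the last row, $\lambda_0=+\infty$; $[m]=\{1,\dots,m\}$; $\delta_m=(m,m-1,\dots,1)$, $\delta_0=\emptyset$. For a Young diagram $Y$ and $d\ge1$, the height of the prime path of row $d$ is $h_Y(d)=\min\{h\ge1:\lambda_{d-h}\ge\lambda_d+h\}$; equivalently, if $Y\subseteq\delta_{n-1}$ is encoded by the Dyck path from $(0,0)$ to $(n,n)$ tracing its boundary (row $d$ corresponding to the $(n-d+1)$-th north step), it is the number of north steps of the prime Dyck subpath (the subpath up to the first return to the slope-one line through its start) beginning with that north step. If $B$ is the last box of row $x_B$, the $B$-strip is the set of last boxes of rows $x_B-h_Y(x_B)+1,\dots,x_B$; $B$ is a corner box if it is also lowest in its column. $Y'\gtrdot Y$ if $Y'$ is $Y$ with the $B$-strip of some corner box $B$ deleted. $\mathcal T_n$ is the set of Young diagrams contained in $\delta_{n-1}$ with the order generated by $\gtrdot$, and a saturated chain is a sequence $Y_0\gtrdot Y_1\gtrdot\cdots\gtrdot Y_l$. -}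

module Defs where

open import Data.Nat using (ℕ; zero; suc; _+_; _∸_; _≤_; _<_; _≤ᵇ_; _<ᵇ_)
open import Data.Nat.Properties using (_≤?_)
open import Data.Bool using (Bool; true; false; if_then_else_; _∧_)
open import Data.List using (List; []; _∷_)
open import Data.Product using (Σ; _×_)
open import Relation.Nullary using (yes; no)
open import Relation.Binary.PropositionalEquality using (_≡_)

-- A Young diagram is the (finite) list of its row lengths λ₁ ≥ λ₂ ≥ ⋯ ≥ λ_k > 0
-- (top to bottom, English notation).  Canonical: no zero rows stored.
data Partition : List ℕ → Set where
  nil  : Partition []
  one  : ∀ {a} → 1 ≤ a → Partition (a ∷ [])
  cons : ∀ {a b rs} → b ≤ a → Partition (b ∷ rs) → Partition (a ∷ b ∷ rs)

-- Row length λ_i for i ≥ 1 (0 beyond the last row).  The value at index 0 is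
-- never used (λ₀ = +∞ is treated separately in `height`).
lam : List ℕ → ℕ → ℕ
lam ys zero = 0
lam [] (suc i) = 0
lam (y ∷ ys) (suc zero) = y
lam (y ∷ ys) (suc (suc i)) = lam ys (suc i)

InStaircase : ℕ → List ℕ → Set
InStaircase n Y = ∀ i → 1 ≤ i → 0 < lam Y i → lam Y i + i ≤ n

heightFrom : List ℕ → ℕ → ℕ → ℕ → ℕ
heightFrom Y d h zero = h
heightFrom Y d h (suc k) with lam Y d + h ≤? lam Y (d ∸ h)
... | yes _ = h
... | no  _ = heightFrom Y d (suc h) k

-- h_Y(d) = min{h ≥ 1 : λ_{d-h} ≥ λ_d + h}  (d ≥ 1, λ₀ = +∞): candidates
-- h = 1, …, d-1 are tested, and h = d always succeeds since λ₀ = +∞.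
height : List ℕ → ℕ → ℕ
height Y d = heightFrom Y d 1 (d ∸ 1)

-- Row i's length after deleting the B-strip of the last box B of row x:
-- rows x - h_Y(x) + 1, …, x lose their last box.
stripDeleted : List ℕ → ℕ → ℕ → ℕ
stripDeleted Y x i =
  if (i ≤ᵇ x) ∧ (x <ᵇ i + height Y x) then lam Y i ∸ 1 else lam Y i

-- The last box of row x is a corner box: row x is nonempty and row x+1 is
-- strictly shorter (so the box is lowest in its column).
IsCorner : List ℕ → ℕ → Set
IsCorner Y x = (1 ≤ x) × (0 < lam Y x) × (lam Y (suc x) < lam Y x)

-- Y' ⋗ Y : Y' is Y with the B-strip of some corner box B deleted.
Covers : List ℕ → List ℕ → Set
Covers Y' Y = Partition Y' × Σ ℕ (λ x → IsCorner Y x ×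
                 (∀ i → 1 ≤ i → lam Y' i ≡ stripDeleted Y x i))

-- Deleting a strip can only lengthen prime paths.  If some h < h_Y(d) had
-- λ'_d + h ≤ λ'_{d-h} in the smaller diagram, then, as every row loses at most
-- one box, the deleted strip (rows t+1, …, x of the prime path of x, where
-- t = x − h_Y(x)) would contain row d but not row d − h, i.e. d − h ≤ t < d.
-- Rows between d and x are short relative to row x, so the inequality
-- λ_x + h_Y(x) ≤ λ_t would make g = d − t ≤ h satisfy λ_d + g ≤ λ_{d−g},
-- contradicting the minimality of h_Y(d).
module Submission where

open import Defs
open import Data.Nat using (ℕ; zero; suc; _+_; _∸_; _≤_; _<_; z≤n; s≤s)
open import Data.Nat.Properties
open import Data.List using (List; [])
open import Data.Product using (_×_; _,_)
open import Data.Sum using (inj₁; inj₂)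
open import Data.Empty using (⊥-elim)
open import Relation.Nullary using (Dec; ¬_; yes; no)
open import Relation.Nullary.Decidable using (_×-dec_; dec-true; dec-false)
open import Relation.Binary.PropositionalEquality using (_≡_; refl; sym; cong; subst; subst₂)

m<n+o⇒m∸o<n : ∀ {m n o} → o ≤ m → m < n + o → m ∸ o < n
m<n+o⇒m∸o<n {m} {n} {o} o≤m lt = subst (m ∸ o <_) (m+n∸n≡m n o) (∸-monoˡ-< lt o≤m)

[m∸1]+n≤o∸1⇒m+n≤o : ∀ m n o → 1 ≤ n → (m ∸ 1) + n ≤ o ∸ 1 → m + n ≤ o
[m∸1]+n≤o∸1⇒m+n≤o m       (suc n) zero    _ le = ⊥-elim (n≮0 (m+n≤o⇒n≤o (m ∸ 1) le))
[m∸1]+n≤o∸1⇒m+n≤o zero    (suc n) (suc o) _ le = ≤-trans le (n≤1+n o)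
[m∸1]+n≤o∸1⇒m+n≤o (suc m) (suc n) (suc o) _ le = s≤s le

Fits : List ℕ → ℕ → ℕ → Set
Fits Y d h = lam Y d + h ≤ lam Y (d ∸ h)

heightFrom-≤ : ∀ Y d h k → heightFrom Y d h k ≤ h + k
heightFrom-≤ Y d h zero = m≤m+n h 0
heightFrom-≤ Y d h (suc k) with lam Y d + h ≤? lam Y (d ∸ h)
... | yes _ = m≤m+n h (suc k)
... | no  _ = subst (heightFrom Y d (suc h) k ≤_) (sym (+-suc h k)) (heightFrom-≤ Y d (suc h) k)

heightFrom-fits : ∀ Y d h k → heightFrom Y d h k < h + k → Fits Y d (heightFrom Y d h k)
heightFrom-fits Y d h zero lt rewrite +-identityʳ h = ⊥-elim (n≮n h lt)
heightFrom-fits Y d h (suc k) lt with lam Y d + h ≤? lam Y (d ∸ h)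
... | yes fits = fits
... | no  _    = heightFrom-fits Y d (suc h) k (subst (heightFrom Y d (suc h) k <_) (+-suc h k) lt)

heightFrom-minimal : ∀ Y d h k {h′} → h ≤ h′ → h′ < heightFrom Y d h k → ¬ Fits Y d h′
heightFrom-minimal Y d h zero h≤h′ lt _ = n≮n h (≤-<-trans h≤h′ lt)
heightFrom-minimal Y d h (suc k) h≤h′ lt with lam Y d + h ≤? lam Y (d ∸ h)
... | yes _ = λ _ → n≮n h (≤-<-trans h≤h′ lt)
... | no ¬fits with m≤n⇒m<n∨m≡n h≤h′
...   | inj₁ h<h′ = heightFrom-minimal Y d (suc h) k h<h′ lt
...   | inj₂ refl = ¬fits

heightFrom-greatest : ∀ Y d h k {H} → H ≤ h + k →
                      (∀ {h′} → h ≤ h′ → h′ < H → ¬ Fits Y d h′) → H ≤ heightFrom Y d h k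
heightFrom-greatest Y d h zero {H} H≤ _ = subst (H ≤_) (+-identityʳ h) H≤
heightFrom-greatest Y d h (suc k) {H} H≤ below with lam Y d + h ≤? lam Y (d ∸ h)
... | yes fits = ≮⇒≥ (λ h<H → below ≤-refl h<H fits)
... | no  _    = heightFrom-greatest Y d (suc h) k (subst (H ≤_) (+-suc h k) H≤)
                   (λ sh≤h′ → below (≤-trans (n≤1+n h) sh≤h′))

height≤ : ∀ Y {d} → 1 ≤ d → height Y d ≤ d
height≤ Y {suc d} _ = heightFrom-≤ Y (suc d) 1 d

height-fits : ∀ Y {d} → height Y d < d → Fits Y d (height Y d)
height-fits Y {suc d} = heightFrom-fits Y (suc d) 1 d

height-minimal : ∀ Y {d h} → 1 ≤ h → h < height Y d → ¬ Fits Y d h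
height-minimal Y {d} = heightFrom-minimal Y d 1 (d ∸ 1)

height-greatest : ∀ Y {d H} → 1 ≤ d → H ≤ d →
                  (∀ {h} → 1 ≤ h → h < H → ¬ Fits Y d h) → H ≤ height Y d
height-greatest Y {suc d} _ = heightFrom-greatest Y (suc d) 1 d

lam[x∸e]≤lam[x]+e : ∀ Y x e → e < height Y x → lam Y (x ∸ e) ≤ lam Y x + e
lam[x∸e]≤lam[x]+e Y x zero    _  = m≤m+n (lam Y x) 0
lam[x∸e]≤lam[x]+e Y x (suc e) lt = <⇒≤ (≰⇒> (height-minimal Y {x} (s≤s z≤n) lt))

InStrip : List ℕ → ℕ → ℕ → Set
InStrip Y x i = i ≤ x × x < i + height Y x

-- `does (inStrip? Y x i)` reduces to the boolean test inside `stripDeleted`.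
inStrip? : ∀ Y x i → Dec (InStrip Y x i)
inStrip? Y x i = (i ≤? x) ×-dec (x <? i + height Y x)

stripDeleted-∈ : ∀ {Y x i} → InStrip Y x i → stripDeleted Y x i ≡ lam Y i ∸ 1
stripDeleted-∈ {Y} {x} {i} p rewrite dec-true (inStrip? Y x i) p = refl

stripDeleted-∉ : ∀ {Y x i} → ¬ InStrip Y x i → stripDeleted Y x i ≡ lam Y i
stripDeleted-∉ {Y} {x} {i} p rewrite dec-false (inStrip? Y x i) p = refl

inStrip-∸ : ∀ Y x d h → 1 ≤ d → h < height Y d → InStrip Y x d → InStrip Y x (d ∸ h)
inStrip-∸ Y x d h 1≤d h<hd (d≤x , x<d+hx) = ≤-trans (m∸n≤m d h) d≤x , ≰⇒> stripEndsBelow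
  where
  hx = height Y x
  a  = d ∸ h
  h<d : h < d
  h<d = <-≤-trans h<hd (height≤ Y 1≤d)
  h≤d : h ≤ d
  h≤d = <⇒≤ h<d
  1≤a : 1 ≤ a
  1≤a = m<n⇒0<n∸m h<d
  stripEndsBelow : ¬ (a + hx ≤ x)
  stripEndsBelow a+hx≤x = height-minimal Y {d} 1≤g (≤-<-trans g≤h h<hd) rowFits
    where
    open ≤-Reasoning
    t = x ∸ hx
    g = d ∸ t
    e = x ∸ d
    hx≤x : hx ≤ x
    hx≤x = m+n≤o⇒n≤o a a+hx≤x
    t<d : t < d
    t<d = m<n+o⇒m∸o<n hx≤x x<d+hx
    1≤g : 1 ≤ g
    1≤g = m<n⇒0<n∸m t<d
    g≤h : g ≤ h
    g≤h = begin
      d ∸ t        ≤⟨ ∸-monoʳ-≤ d (m+n≤o⇒m≤o∸n a a+hx≤x) ⟩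
      d ∸ (d ∸ h)  ≡⟨ m∸[m∸n]≡n h≤d ⟩
      h            ∎
    e+g≡hx : e + g ≡ hx
    e+g≡hx = begin-equality
      (x ∸ d) + (d ∸ t)  ≡⟨ +-∸-assoc (x ∸ d) (<⇒≤ t<d) ⟨
      (x ∸ d) + d ∸ t    ≡⟨ cong (_∸ t) (m∸n+n≡m d≤x) ⟩
      x ∸ (x ∸ hx)       ≡⟨ m∸[m∸n]≡n hx≤x ⟩
      hx                 ∎
    rowFits : Fits Y d g
    rowFits = begin
      lam Y d + g            ≡⟨ cong (λ r → lam Y r + g) (m∸[m∸n]≡n d≤x) ⟨
      lam Y (x ∸ e) + g      ≤⟨ +-monoˡ-≤ g (lam[x∸e]≤lam[x]+e Y x e
                                  (m<n+o⇒m∸o<n d≤x (subst (x <_) (+-comm d hx) x<d+hx))) ⟩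
      lam Y x + e + g        ≡⟨ +-assoc (lam Y x) e g ⟩
      lam Y x + (e + g)      ≡⟨ cong (lam Y x +_) e+g≡hx ⟩
      lam Y x + hx           ≤⟨ height-fits Y (<-≤-trans (m<n+m hx 1≤a) a+hx≤x) ⟩
      lam Y t                ≡⟨ cong (lam Y) (m∸[m∸n]≡n (<⇒≤ t<d)) ⟨
      lam Y (d ∸ g)          ∎

fits-before-stripDeleted : ∀ Y x d h → 1 ≤ d → 1 ≤ h → h < height Y d →
                           stripDeleted Y x d + h ≤ stripDeleted Y x (d ∸ h) → Fits Y d h
fits-before-stripDeleted Y x d h 1≤d 1≤h h<hd fits′
  with inStrip? Y x d | inStrip? Y x (d ∸ h)
... | yes d∈ | yes a∈ rewrite stripDeleted-∈ d∈ | stripDeleted-∈ a∈ =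
  [m∸1]+n≤o∸1⇒m+n≤o (lam Y d) h (lam Y (d ∸ h)) 1≤h fits′
... | no d∉  | yes a∈ rewrite stripDeleted-∉ d∉ | stripDeleted-∈ a∈ =
  ≤-trans fits′ (m∸n≤m (lam Y (d ∸ h)) 1)
... | no d∉  | no a∉  rewrite stripDeleted-∉ d∉ | stripDeleted-∉ a∉ = fits′
... | yes d∈ | no a∉  = ⊥-elim (a∉ (inStrip-∸ Y x d h 1≤d h<hd d∈))

height≤height-stripDeleted : ∀ Y Y′ x → (∀ i → 1 ≤ i → lam Y′ i ≡ stripDeleted Y x i) →
                             ∀ d → 1 ≤ d → height Y d ≤ height Y′ d
height≤height-stripDeleted Y Y′ x rows d 1≤d =
  height-greatest Y′ 1≤d (height≤ Y 1≤d) λ {h} 1≤h h<hd fits′ →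
    height-minimal Y 1≤h h<hd (fits-before-stripDeleted Y x d h 1≤d 1≤h h<hd
      (subst₂ (λ u v → u + h ≤ v) (rows d 1≤d)
              (rows (d ∸ h) (m<n⇒0<n∸m (<-≤-trans h<hd (height≤ Y 1≤d)))) fits′))

covers⇒height≤ : ∀ {Y′ Y} → Covers Y′ Y → ∀ d → 1 ≤ d → height Y d ≤ height Y′ d
covers⇒height≤ (_ , x , _ , rows) = height≤height-stripDeleted _ _ x rows

-- Only the covering relations matter; the staircase bound and Y 0 ≡ [] are unused.
proposition3p7 : (n : ℕ) → 1 ≤ n → (l : ℕ) → (Y : ℕ → List ℕ) →
    (∀ j → j ≤ l → Partition (Y j) × InStaircase n (Y j)) →
    Y 0 ≡ [] →
    (∀ j → j < l → Covers (Y j) (Y (suc j))) →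
    (d : ℕ) → 1 ≤ d → d ≤ n →
    ∀ j → j < l → height (Y (suc j)) d ≤ height (Y j) d
proposition3p7 n _ l Y _ _ cov d 1≤d _ j j<l = covers⇒height≤ (cov j j<l) d 1≤d
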